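{- Let $p$ be a prime and let $n,k,r$ be positive integers with $p^r>2$. Let $M_{p^r}(n,k)$ denote the number of $n$-tuples $(k_1,k_2,\ldots,k_n)$ of nonnegative integers such that $$k_1+k_2+\cdots+k_n=k,\qquad k_1+2k_2+\cdots+nk_n=n,\qquad \frac{k!}{k_1!\,k_2!\cdots k_n!}=p^r.$$ Then $$ M_{p^r}(n,k)=\delta_{p^r,\,k}\left(\left\lfloor\frac{n-1}{p^r-1}\right\rfloor -\delta_{0,\,n\bmod p^r} \right), $$ where $\delta_{i,j}$ is the Kronecker delta, $\lfloor x\rfloor$ is the largest integer not exceeding $x$, and $n\bmod p^r$ is the remainder of $n$ upon division by $p^r$.
   Context: The multinomial coefficient is $\binom{k}{k_1,k_2,\ldots,k_n}=\frac{k!}{k_1!k_2!\cdots k_n!}$ where $k=k_1+\cdots+k_n$. -}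

module Defs where

open import Data.Nat using (_!; ℕ; zero; suc; _+_; _*_; _≤?_; _≟_; NonZero)
open import Data.Nat.Properties using (m*n≢0)
open import Data.Nat.Properties using (_!≢0)
open import Data.Nat.DivMod using (_/_)
open import Data.Fin using (Fin; toℕ)
open import Data.Vec using (Vec; []; _∷_; foldr; zipWith; tabulate; allFin)
open import Data.List using (List; []; _∷_; concatMap; map; filter; length; upTo)
open import Data.Product using (_×_)
open import Relation.Nullary.Decidable using (_×-dec_; yes; no)
open import Relation.Binary.PropositionalEquality using (_≡_)

prodFact : ∀ {n} → Vec ℕ n → ℕ
prodFact [] = 1
prodFact (x ∷ xs) = x ! * prodFact xs

prodFact≢0 : ∀ {n} (v : Vec ℕ n) → NonZero (prodFact v)
prodFact≢0 [] = _
prodFact≢0 (x ∷ xs) = m*n≢0 (x !) (prodFact xs) {{x !≢0}} {{prodFact≢0 xs}}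

sumV : ∀ {n} → Vec ℕ n → ℕ
sumV = foldr _ _+_ 0

multinomial : ∀ {n} → Vec ℕ n → ℕ
multinomial v = (sumV v !) / prodFact v
  where instance _ = prodFact≢0 v

weightedSum : ∀ {n} → Vec ℕ n → ℕ
weightedSum {n} v = sumV (zipWith (λ (i : Fin n) x → suc (toℕ i) * x) (allFin n) v)

tuplesBounded : (n k : ℕ) → List (Vec ℕ n)
tuplesBounded zero k = [] ∷ []
tuplesBounded (suc n) k = concatMap (λ x → map (x ∷_) (tuplesBounded n k)) (upTo (suc k))

-- M_q(n,k): number of n-tuples of nonnegative integers satisfying Cond.
-- Any such tuple has every entry ≤ k (since they sum to k), so enumerating
-- entries in {0,…,k} counts all of them.
M : (q n k : ℕ) → ℕ
M q n k = length (filter (λ v → (sumV v ≟ k) ×-dec ((weightedSum v ≟ n) ×-dec (multinomial v ≟ q)))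
                         (tuplesBounded n k))

δ : ℕ → ℕ → ℕ
δ i j with i ≟ j
... | yes _ = 1
... | no _ = 0

{-# OPTIONS --safe #-}

-- Writing the multinomial coefficient of (k₁, …, kₙ) as the product of the binomials
-- C(kᵢ + kᵢ₊₁ + ⋯ + kₙ, kᵢ), it equals q = p^r only if no factor is C(s + t, s) with s, t ≥ 2.
-- Such a binomial is never a power of p: its p-part is at most s + t (induct on the base-p
-- digits of s and t, as in Kummer's theorem), while C(s + t, s) > s + t. Hence a counted tuple
-- has k = q and is (q - 1) eᵤ + eᵥ with u ≠ v and (q - 1) u + v = n. The pairs u, v ≥ 1 with
-- (q - 1) u + v = n number ⌊(n - 1)/(q - 1)⌋, and the diagonal u = v occurs exactly when q ∣ n.

module Submission where

open import Defs
open import Data.Nat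
open import Data.Nat.Properties
open import Data.Nat.Tactic.RingSolver using (solve-∀)
open import Data.Nat.DivMod using (_/_; _%_; m*n/n≡m; m%n<n; m≡m%n+[m/n]*n; m/n*n≤m; /-monoˡ-≤; m/n≤m)
open import Data.Fin using (Fin; toℕ) renaming (zero to fzero; suc to fsuc)
open import Data.Vec using (Vec; []; _∷_; zipWith; tabulate)
open import Data.Product using (_×_; _,_; proj₁; ∃-syntax)
open import Data.Sum using (inj₁; inj₂)
open import Relation.Nullary using (¬_; Dec; yes; no; contradiction)
open import Relation.Binary.PropositionalEquality
open import Relation.Unary using (Decidable)
open import Function using (_∘_)
open import Data.List using (List; []; _∷_; map; filter; length; concatMap; applyUpTo; upTo; _++_)
open import Data.List.Properties using (map-cong; map-++; map-∘)
open import Data.Nat.ListAction using (sum)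
open import Data.Nat.ListAction.Properties using (sum-++)
open import Data.Nat.Divisibility
open import Data.Nat.Primality using (Prime; euclidsLemma; prime⇒irreducible; prime⇒nonZero; prime⇒nonTrivial)
open import Data.Nat.Coprimality using (Coprime; coprime-divisor)

δ-refl : ∀ i → δ i i ≡ 1
δ-refl i with i ≟ i
... | yes _ = refl
... | no i≢i = contradiction refl i≢i

δ-≢ : ∀ {i j} → i ≢ j → δ i j ≡ 0
δ-≢ {i} {j} i≢j with i ≟ j
... | yes i≡j = contradiction i≡j i≢j
... | no _ = refl

δ≢0⇒≡ : ∀ {i j} → δ i j ≢ 0 → i ≡ j
δ≢0⇒≡ {i} {j} δ≢0 with i ≟ j
... | yes i≡j = i≡j
... | no _ = contradiction refl δ≢0

1≤n∸m⇒m+[n∸m]≡n : ∀ m n → 1 ≤ n ∸ m → m + (n ∸ m) ≡ n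
1≤n∸m⇒m+[n∸m]≡n m n 1≤n∸m = m+[n∸m]≡n {m} (<⇒≤ (m∸n≢0⇒n<m λ n∸m≡0 → <⇒≱ 1≤n∸m (≤-reflexive n∸m≡0)))

δ-+ : ∀ a v w → 1 ≤ v → δ (a + v) w ≡ δ v (w ∸ a)
δ-+ a v w 1≤v = by-cases (a + v ≟ w)
  where
  by-cases : Dec (a + v ≡ w) → δ (a + v) w ≡ δ v (w ∸ a)
  by-cases (yes refl) = trans (δ-refl (a + v)) (sym (trans (cong (δ v) (m+n∸m≡n a v)) (δ-refl v)))
  by-cases (no a+v≢w) = trans (δ-≢ a+v≢w) (sym (δ-≢ v≢w∸a))
    where
    v≢w∸a : v ≢ w ∸ a
    v≢w∸a v≡w∸a = a+v≢w (trans (cong (a +_) v≡w∸a) (1≤n∸m⇒m+[n∸m]≡n a w (≤-trans 1≤v (≤-reflexive v≡w∸a))))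

-- binomial a b = (a + b)! / (a! b!), built by Pascal's rule.
binomial : ℕ → ℕ → ℕ
binomial zero b = 1
binomial (suc a) zero = 1
binomial (suc a) (suc b) = binomial a (suc b) + binomial (suc a) b

binomial-*-! : ∀ a b → binomial a b * (a ! * b !) ≡ (a + b) !
binomial-*-! zero b = trans (+-identityʳ _) (+-identityʳ _)
binomial-*-! (suc a) zero =
  trans (+-identityʳ _) (trans (*-identityʳ _) (cong _! (sym (+-identityʳ (suc a)))))
binomial-*-! (suc a) (suc b) = begin
    (B₁ + B₂) * ((suc a * a !) * (suc b * b !))
  ≡⟨ regroup B₁ B₂ (a !) (b !) (suc a) (suc b) ⟩
    suc a * (B₁ * (a ! * (suc b * b !))) + suc b * (B₂ * ((suc a * a !) * b !))
  ≡⟨ cong₂ (λ u v → suc a * u + suc b * v)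
       (binomial-*-! a (suc b)) (trans (binomial-*-! (suc a) b) (cong _! (sym (+-suc a b)))) ⟩
    suc a * (a + suc b) ! + suc b * (a + suc b) !
  ≡⟨ *-distribʳ-+ ((a + suc b) !) (suc a) (suc b) ⟨
    (suc a + suc b) * (a + suc b) !
  ∎
  where
  open ≡-Reasoning
  B₁ = binomial a (suc b)
  B₂ = binomial (suc a) b
  regroup : ∀ x y u v m n → (x + y) * ((m * u) * (n * v)) ≡ m * (x * (u * (n * v))) + n * (y * ((m * u) * v))
  regroup = solve-∀

binomial-0ʳ : ∀ a → binomial a 0 ≡ 1
binomial-0ʳ zero = refl
binomial-0ʳ (suc a) = refl

binomial-1ˡ : ∀ b → binomial 1 b ≡ suc b
binomial-1ˡ zero = refl
binomial-1ˡ (suc b) = cong suc (binomial-1ˡ b)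

binomial-1ʳ : ∀ a → binomial a 1 ≡ suc a
binomial-1ʳ zero = refl
binomial-1ʳ (suc a) = trans (cong₂ _+_ (binomial-1ʳ a) (binomial-0ʳ (suc a))) (+-comm (suc a) 1)

binomial-absorb : ∀ a b → suc (a + b) * binomial a b ≡ suc a * binomial (suc a) b
binomial-absorb a b = *-cancelʳ-≡ _ _ (a ! * b !) {{m*n≢0 _ _ {{a !≢0}} {{b !≢0}}}} (begin
    suc (a + b) * binomial a b * (a ! * b !)
  ≡⟨ *-assoc (suc (a + b)) (binomial a b) _ ⟩
    suc (a + b) * (binomial a b * (a ! * b !))
  ≡⟨ cong (suc (a + b) *_) (binomial-*-! a b) ⟩
    suc (a + b) * (a + b) !
  ≡⟨ binomial-*-! (suc a) b ⟨
    binomial (suc a) b * ((suc a * a !) * b !)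
  ≡⟨ regroup (suc a) (binomial (suc a) b) (a !) (b !) ⟩
    suc a * binomial (suc a) b * (a ! * b !)
  ∎)
  where
  open ≡-Reasoning
  regroup : ∀ m B x y → B * ((m * x) * y) ≡ m * B * (x * y)
  regroup = solve-∀

binomial≥1 : ∀ a b → 1 ≤ binomial a b
binomial≥1 zero b = ≤-refl
binomial≥1 (suc a) zero = ≤-refl
binomial≥1 (suc a) (suc b) = ≤-trans (binomial≥1 a (suc b)) (m≤m+n _ _)

binomial-lowerBound : ∀ a b → 2 + (a + b) ≤ binomial (suc a) (suc b)
binomial-lowerBound zero b = ≤-reflexive (sym (binomial-1ˡ (suc b)))
binomial-lowerBound (suc a) b =
  ≤-trans (≤-reflexive (+-comm 1 (2 + (a + b)))) (+-mono-≤ (binomial-lowerBound a b) (binomial≥1 (2 + a) b))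

binomial-2+-> : ∀ a b → 2 + a + (2 + b) < binomial (2 + a) (2 + b)
binomial-2+-> a b = begin-strict
    2 + a + (2 + b)
  <⟨ m<m+n (2 + a + (2 + b)) {2 + (a + b)} z<s ⟩
    2 + a + (2 + b) + (2 + (a + b))
  ≡⟨ rearrange a b ⟩
    (2 + (a + suc b)) + (2 + (suc a + b))
  ≤⟨ +-mono-≤ (binomial-lowerBound a (suc b)) (binomial-lowerBound (suc a) b) ⟩
    binomial (2 + a) (2 + b)
  ∎
  where
  open ≤-Reasoning
  rearrange : ∀ a b → 2 + a + (2 + b) + (2 + (a + b)) ≡ (2 + (a + suc b)) + (2 + (suc a + b))
  rearrange = solve-∀

binomial-ratio : ∀ S T A B ws wt Y .{{_ : NonZero A}} .{{_ : NonZero B}} →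
  S ! ≡ A * ws → T ! ≡ B * wt → (S + T) ! ≡ A * B * Y → binomial S T * (ws * wt) ≡ Y
binomial-ratio S T A B ws wt Y S!≡ T!≡ [S+T]!≡ = *-cancelˡ-≡ _ _ (A * B) {{m*n≢0 A B}} (begin
    A * B * (binomial S T * (ws * wt))
  ≡⟨ regroup A B (binomial S T) ws wt ⟩
    binomial S T * ((A * ws) * (B * wt))
  ≡⟨ cong₂ (λ u v → binomial S T * (u * v)) S!≡ T!≡ ⟨
    binomial S T * (S ! * T !)
  ≡⟨ binomial-*-! S T ⟩
    (S + T) !
  ≡⟨ [S+T]!≡ ⟩
    A * B * Y
  ∎)
  where
  open ≡-Reasoning
  regroup : ∀ A B C u v → A * B * (C * (u * v)) ≡ C * ((A * u) * (B * v))
  regroup = solve-∀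

^-!-split : ∀ p s t w → p ^ (s + t) * (s + t) ! * w ≡ (p ^ s * s !) * (p ^ t * t !) * (binomial s t * w)
^-!-split p s t w = begin
    p ^ (s + t) * (s + t) ! * w
  ≡⟨ cong₂ (λ u v → u * v * w) (^-distribˡ-+-* p s t) (sym (binomial-*-! s t)) ⟩
    p ^ s * p ^ t * (binomial s t * (s ! * t !)) * w
  ≡⟨ regroup (p ^ s) (p ^ t) (s !) (t !) (binomial s t) w ⟩
    (p ^ s * s !) * (p ^ t * t !) * (binomial s t * w)
  ∎
  where
  open ≡-Reasoning
  regroup : ∀ P Q x y C w → P * Q * (C * (x * y)) * w ≡ (P * x) * (Q * y) * (C * w)
  regroup = solve-∀

^-!-split-carry : ∀ p s t w →
  p ^ suc (s + t) * suc (s + t) ! * w ≡ (p ^ s * s !) * (p ^ t * t !) * (p * (suc s * binomial (suc s) t) * w)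
^-!-split-carry p s t w = begin
    p * p ^ (s + t) * (suc (s + t) * (s + t) !) * w
  ≡⟨ regroup p (p ^ (s + t)) (suc (s + t)) ((s + t) !) w ⟩
    p * (suc (s + t) * (p ^ (s + t) * (s + t) ! * w))
  ≡⟨ cong (λ u → p * (suc (s + t) * u)) (^-!-split p s t w) ⟩
    p * (suc (s + t) * (P * (binomial s t * w)))
  ≡⟨ regroup′ p (suc (s + t)) P (binomial s t) w ⟩
    P * (p * (suc (s + t) * binomial s t) * w)
  ≡⟨ cong (λ u → P * (p * u * w)) (binomial-absorb s t) ⟩
    P * (p * (suc s * binomial (suc s) t) * w)
  ∎
  where
  open ≡-Reasoning
  P = (p ^ s * s !) * (p ^ t * t !)
  regroup : ∀ p Q m f w → p * Q * (m * f) * w ≡ p * (m * (Q * f * w))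
  regroup = solve-∀
  regroup′ : ∀ p m P C w → p * (m * (P * (C * w))) ≡ P * (p * (m * C) * w)
  regroup′ = solve-∀

binomialProduct : ∀ {n} → Vec ℕ n → ℕ
binomialProduct [] = 1
binomialProduct (x ∷ xs) = binomial x (sumV xs) * binomialProduct xs

binomialProduct-*-prodFact : ∀ {n} (v : Vec ℕ n) → binomialProduct v * prodFact v ≡ sumV v !
binomialProduct-*-prodFact [] = refl
binomialProduct-*-prodFact (x ∷ xs) = begin
    binomial x s * binomialProduct xs * (x ! * prodFact xs)
  ≡⟨ regroup (binomial x s) (binomialProduct xs) (x !) (prodFact xs) ⟩
    binomial x s * (x ! * (binomialProduct xs * prodFact xs))
  ≡⟨ cong (λ u → binomial x s * (x ! * u)) (binomialProduct-*-prodFact xs) ⟩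
    binomial x s * (x ! * s !)
  ≡⟨ binomial-*-! x s ⟩
    (x + s) !
  ∎
  where
  open ≡-Reasoning
  s = sumV xs
  regroup : ∀ a b c d → a * b * (c * d) ≡ a * (c * (b * d))
  regroup = solve-∀

multinomial≡binomialProduct : ∀ {n} (v : Vec ℕ n) → multinomial v ≡ binomialProduct v
multinomial≡binomialProduct v = begin
    sumV v ! / prodFact v
  ≡⟨ cong (_/ prodFact v) (binomialProduct-*-prodFact v) ⟨
    binomialProduct v * prodFact v / prodFact v
  ≡⟨ m*n/n≡m (binomialProduct v) (prodFact v) ⟩
    binomialProduct v
  ∎
  where
  open ≡-Reasoning
  instance _ = prodFact≢0 v

sum≡0⇒binomialProduct≡1 : ∀ {n} (v : Vec ℕ n) → sumV v ≡ 0 → binomialProduct v ≡ 1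
sum≡0⇒binomialProduct≡1 [] _ = refl
sum≡0⇒binomialProduct≡1 (zero ∷ xs) s≡0 = trans (+-identityʳ _) (sum≡0⇒binomialProduct≡1 xs s≡0)

weightedSumFrom : ∀ {n} → ℕ → Vec ℕ n → ℕ
weightedSumFrom c [] = 0
weightedSumFrom c (x ∷ xs) = c * x + weightedSumFrom (suc c) xs

weightedSum-tabulate : ∀ {m j} (f : Fin m → Fin j) (h : Fin j → ℕ) c → (∀ i → h (f i) ≡ c + toℕ i) →
  (v : Vec ℕ m) → sumV (zipWith (λ i x → h i * x) (tabulate f) v) ≡ weightedSumFrom c v
weightedSum-tabulate f h c hf [] = refl
weightedSum-tabulate f h c hf (x ∷ xs) =
  cong₂ _+_ (cong (_* x) (trans (hf fzero) (+-identityʳ c)))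
            (weightedSum-tabulate (f ∘ fsuc) h (suc c) (λ i → trans (hf (fsuc i)) (+-suc c (toℕ i))) xs)

weightedSum≡weightedSumFrom1 : ∀ {n} (v : Vec ℕ n) → weightedSum v ≡ weightedSumFrom 1 v
weightedSum≡weightedSumFrom1 = weightedSum-tabulate (λ i → i) (λ i → suc (toℕ i)) 1 (λ _ → refl)

sum≤weightedSumFrom : ∀ {n} c (v : Vec ℕ n) → sumV v ≤ weightedSumFrom (suc c) v
sum≤weightedSumFrom c [] = z≤n
sum≤weightedSumFrom c (x ∷ xs) = +-mono-≤ (m≤n*m x (suc c)) (sum≤weightedSumFrom (suc c) xs)

-- Powers of a prime dividing binomial coefficients

module PrimePowers {p : ℕ} (prime : Prime p) where

  private instance
    p≢0 : NonZero p
    p≢0 = prime⇒nonZero prime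

  1<p : 1 < p
  1<p = nonTrivial⇒n>1 p {{prime⇒nonTrivial prime}}

  p∤1 : ¬ p ∣ 1
  p∤1 p∣1 = <⇒≢ 1<p (sym (∣1⇒≡1 p∣1))

  p∤*-closed : ∀ {m n} → ¬ p ∣ m → ¬ p ∣ n → ¬ p ∣ m * n
  p∤*-closed {m} {n} p∤m p∤n p∣mn with euclidsLemma m n prime p∣mn
  ... | inj₁ p∣m = p∤m p∣m
  ... | inj₂ p∣n = p∤n p∣n

  p∤p*y+a : ∀ y a → 0 < a → a < p → ¬ p ∣ p * y + a
  p∤p*y+a y a 0<a a<p p∣ = <⇒≱ a<p (∣⇒≤ {{>-nonZero 0<a}} (∣m+n∣m⇒∣n p∣ (m∣m*n y)))

  p^e∣m*n⇒p^e∣m : ∀ e {m n} → ¬ p ∣ n → p ^ e ∣ m * n → p ^ e ∣ m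
  p^e∣m*n⇒p^e∣m zero {m} _ _ = 1∣ m
  p^e∣m*n⇒p^e∣m (suc e) {m} {n} p∤n p^e∣mn with euclidsLemma m n prime (∣-trans (m∣m*n (p ^ e)) p^e∣mn)
  ... | inj₂ p∣n = contradiction p∣n p∤n
  ... | inj₁ (divides m′ refl) = subst (p * p ^ e ∣_) (*-comm p m′) (*-monoʳ-∣ p p^e∣m′)
    where
    p^e∣m′ : p ^ e ∣ m′
    p^e∣m′ = p^e∣m*n⇒p^e∣m e p∤n (*-cancelˡ-∣ p (subst (p * p ^ e ∣_) (regroup m′ p n) p^e∣mn))
      where
      regroup : ∀ m′ p n → m′ * p * n ≡ p * (m′ * n)
      regroup = solve-∀

  ∣p^⇒≡p^ : ∀ r {d} → d ∣ p ^ r → ∃[ e ] d ≡ p ^ e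
  ∣p^⇒≡p^ zero d∣1 = 0 , ∣1⇒≡1 d∣1
  ∣p^⇒≡p^ (suc r) {d} d∣p^r with p ∣? d
  ... | yes (divides d′ refl) with ∣p^⇒≡p^ r (*-cancelˡ-∣ p (subst (_∣ p * p ^ r) (*-comm d′ p) d∣p^r))
  ...   | e , refl = suc e , *-comm (p ^ e) p
  ∣p^⇒≡p^ (suc r) {d} d∣p^r | no p∤d = ∣p^⇒≡p^ r (coprime-divisor d⊥p d∣p^r)
    where
    d⊥p : Coprime d p
    d⊥p (c∣d , c∣p) with prime⇒irreducible prime c∣p
    ... | inj₁ c≡1 = c≡1
    ... | inj₂ refl = contradiction c∣d p∤d

  private
    p₋₁ = pred p

    1+p₋₁≡p : suc p₋₁ ≡ p
    1+p₋₁≡p = suc-pred p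

    p₋₁<p : p₋₁ < p
    p₋₁<p = ≤-reflexive 1+p₋₁≡p

  factorial-split : ∀ y a → a < p → ∃[ w ] ¬ p ∣ w × (p * y + a) ! ≡ p ^ y * y ! * w
  factorial-split zero zero _ = 1 , p∤1 , cong _! (trans (+-identityʳ (p * 0)) (*-zeroʳ p))
  factorial-split (suc y) zero _ with factorial-split y p₋₁ p₋₁<p
  ... | w , p∤w , eq = w , p∤w , (begin
      (p * suc y + 0) !
    ≡⟨ cong _! last-digit ⟨
      suc (p * y + p₋₁) * (p * y + p₋₁) !
    ≡⟨ cong₂ _*_ last-digit eq ⟩
      (p * suc y + 0) * (p ^ y * y ! * w)
    ≡⟨ regroup p y (p ^ y) (y !) w ⟩
      p * p ^ y * (suc y * y !) * w
    ∎)
    where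
    open ≡-Reasoning
    last-digit : suc (p * y + p₋₁) ≡ p * suc y + 0
    last-digit = begin
        suc (p * y + p₋₁)  ≡⟨ +-suc (p * y) p₋₁ ⟨
        p * y + suc p₋₁    ≡⟨ cong (p * y +_) 1+p₋₁≡p ⟩
        p * y + p          ≡⟨ +-comm (p * y) p ⟩
        p + p * y          ≡⟨ *-suc p y ⟨
        p * suc y          ≡⟨ +-identityʳ (p * suc y) ⟨
        p * suc y + 0      ∎
    regroup : ∀ p y P f w → (p * suc y + 0) * (P * f * w) ≡ p * P * (suc y * f) * w
    regroup = solve-∀
  factorial-split y (suc a) a<p with factorial-split y a (<-trans (n<1+n a) a<p)
  ... | w , p∤w , eq = suc (p * y + a) * w , p∤*-closed p∤N p∤w , (begin
      (p * y + suc a) !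
    ≡⟨ cong _! (+-suc (p * y) a) ⟩
      suc (p * y + a) * (p * y + a) !
    ≡⟨ cong (suc (p * y + a) *_) eq ⟩
      suc (p * y + a) * (p ^ y * y ! * w)
    ≡⟨ x∙yz≈y∙xz (suc (p * y + a)) (p ^ y * y !) w ⟩
      p ^ y * y ! * (suc (p * y + a) * w)
    ∎)
    where
    open ≡-Reasoning
    open import Algebra.Properties.CommutativeSemigroup *-commutativeSemigroup using (x∙yz≈y∙xz)
    p∤N : ¬ p ∣ suc (p * y + a)
    p∤N = subst (λ n → ¬ p ∣ n) (+-suc (p * y) a) (p∤p*y+a y (suc a) z<s a<p)

  private
    p^*!≢0 : ∀ y → NonZero (p ^ y * y !)
    p^*!≢0 y = m*n≢0 (p ^ y) (y !) {{m^n≢0 p y}} {{y !≢0}}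

    m<p*m : ∀ {m} → 1 ≤ m → m < p * m
    m<p*m {m} 1≤m = subst (m <_) (*-comm m p) (m<m*n m p {{>-nonZero 1≤m}} 1<p)

    p^-step : ∀ {e m n} → p ^ e ≤ m → p * m ≤ n → p ^ suc e ≤ n
    p^-step p^e≤m pm≤n = ≤-trans (*-monoʳ-≤ p p^e≤m) pm≤n

    digits-+ : ∀ s′ b t′ c → p * s′ + b + (p * t′ + c) ≡ p * (s′ + t′) + (b + c)
    digits-+ = rearrange p
      where
      rearrange : ∀ p s′ b t′ c → p * s′ + b + (p * t′ + c) ≡ p * (s′ + t′) + (b + c)
      rearrange = solve-∀

    p*[s′+t′]≤ : ∀ s′ b t′ c → p * (s′ + t′) ≤ p * s′ + b + (p * t′ + c)
    p*[s′+t′]≤ s′ b t′ c = subst (p * (s′ + t′) ≤_) (sym (digits-+ s′ b t′ c)) (m≤m+n _ _)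

  digits : ∀ x → ∃[ y ] ∃[ a ] a < p × x ≡ p * y + a
  digits x = x / p , x % p , m%n<n x p , (begin
      x                  ≡⟨ m≡m%n+[m/n]*n x p ⟩
      x % p + x / p * p  ≡⟨ +-comm (x % p) _ ⟩
      x / p * p + x % p  ≡⟨ cong (_+ x % p) (*-comm (x / p) p) ⟩
      p * (x / p) + x % p ∎)
    where open ≡-Reasoning

  -- Removing the last base-p digits b, c of s = p s′ + b and t = p t′ + c turns binomial s t
  -- into binomial s′ t′, up to a factor prime to p and one factor p when b + c ≥ p.
  noCarry-divides : ∀ {s′ b t′ c} e → b < p → c < p → b + c < p →
    p ^ e ∣ (p * s′ + b) * binomial (p * s′ + b) (p * t′ + c) → p ^ e ∣ (p * s′ + b) * binomial s′ t′
  noCarry-divides {s′} {b} {t′} {c} e b<p c<p b+c<p p^e∣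
    with factorial-split s′ b b<p | factorial-split t′ c c<p | factorial-split (s′ + t′) (b + c) b+c<p
  ... | ws , _ , S!≡ | wt , _ , T!≡ | w , p∤w , N!≡ =
    p^e∣m*n⇒p^e∣m e p∤w (subst (p ^ e ∣_) reduce (∣-trans p^e∣ (m∣m*n (ws * wt))))
    where
    S = p * s′ + b
    T = p * t′ + c
    ratio : binomial S T * (ws * wt) ≡ binomial s′ t′ * w
    ratio = binomial-ratio S T (p ^ s′ * s′ !) (p ^ t′ * t′ !) ws wt (binomial s′ t′ * w)
      {{p^*!≢0 s′}} {{p^*!≢0 t′}} S!≡ T!≡
      (trans (cong _! (digits-+ s′ b t′ c)) (trans N!≡ (^-!-split p s′ t′ w)))
    reduce : S * binomial S T * (ws * wt) ≡ S * binomial s′ t′ * w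
    reduce = trans (*-assoc S _ _) (trans (cong (S *_) ratio) (sym (*-assoc S _ _)))

  carry-divides : ∀ {s′ b t′ c d} e → b < p → c < p → b + c ≡ p + d →
    p ^ e ∣ binomial (p * s′ + b) (p * t′ + c) → p ^ e ∣ p * (suc s′ * binomial (suc s′) t′)
  carry-divides {s′} {b} {t′} {c} {d} e b<p c<p b+c≡p+d p^e∣
    with factorial-split s′ b b<p | factorial-split t′ c c<p | factorial-split (suc (s′ + t′)) d d<p
    where
    d<p : d < p
    d<p = +-cancelˡ-< p d p (subst (_< p + p) b+c≡p+d (+-mono-< b<p c<p))
  ... | ws , _ , S!≡ | wt , _ , T!≡ | w , p∤w , N!≡ =
    p^e∣m*n⇒p^e∣m e p∤w (subst (p ^ e ∣_) ratio (∣-trans p^e∣ (m∣m*n (ws * wt))))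
    where
    S+T≡ : p * s′ + b + (p * t′ + c) ≡ p * suc (s′ + t′) + d
    S+T≡ = trans (digits-+ s′ b t′ c) (trans (cong (p * (s′ + t′) +_) b+c≡p+d) (carry-+ p (s′ + t′) d))
      where
      carry-+ : ∀ p m d → p * m + (p + d) ≡ p * suc m + d
      carry-+ = solve-∀
    ratio : binomial (p * s′ + b) (p * t′ + c) * (ws * wt) ≡ p * (suc s′ * binomial (suc s′) t′) * w
    ratio = binomial-ratio (p * s′ + b) (p * t′ + c) (p ^ s′ * s′ !) (p ^ t′ * t′ !) ws wt _
      {{p^*!≢0 s′}} {{p^*!≢0 t′}} S!≡ T!≡
      (trans (cong _! S+T≡) (trans N!≡ (^-!-split-carry p s′ t′ w)))

  -- The factor s makes the induction go through: after a carry, the cofactor of p in binomial s t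
  -- is (s′ + 1) * binomial (s′ + 1) t′ up to a unit (carry-divides).
  Bound : ℕ → ℕ → Set
  Bound s t = ∀ e → 1 ≤ s → p ^ e ∣ s * binomial s t → p ^ e ≤ s + t

  private
    Smaller : ℕ → Set
    Smaller n = ∀ s t → s + t < n → Bound s t

  noCarry : ∀ s′ b t′ c → b < p → c < p → b + c < p →
    Smaller (p * s′ + b + (p * t′ + c)) → Bound (p * s′ + b) (p * t′ + c)
  noCarry s′ zero t′ c _ _ _ _ zero 1≤S _ = ≤-trans 1≤S (m≤m+n _ _)
  noCarry s′ zero t′ c b<p c<p b+c<p IH (suc e) 1≤S p^e∣ =
    p^-step {e} (IH s′ t′ s′+t′< e 1≤s′ p^e∣s′C) (p*[s′+t′]≤ s′ 0 t′ c)
    where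
    S≡p*s′ : p * s′ + 0 ≡ p * s′
    S≡p*s′ = +-identityʳ (p * s′)
    1≤s′ : 1 ≤ s′
    1≤s′ = n≢0⇒n>0 (λ { refl → <⇒≱ 1≤S (≤-reflexive (trans S≡p*s′ (*-zeroʳ p))) })
    p^e∣s′C : p ^ e ∣ s′ * binomial s′ t′
    p^e∣s′C = *-cancelˡ-∣ p (subst (p * p ^ e ∣_) (trans (cong (_* binomial s′ t′) S≡p*s′) (*-assoc p s′ _))
                (noCarry-divides (suc e) b<p c<p b+c<p p^e∣))
    s′+t′< : s′ + t′ < p * s′ + 0 + (p * t′ + c)
    s′+t′< = <-≤-trans (m<p*m (≤-trans 1≤s′ (m≤m+n s′ t′))) (p*[s′+t′]≤ s′ 0 t′ c)
  noCarry s′ (suc b) t′ c b<p c<p b+c<p IH e 1≤S p^e∣ with s′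
  ... | zero = ≤-trans (∣⇒≤ p^e∣C) (≤-trans 1≤S (m≤m+n _ _))
    where
    p^e∣C : p ^ e ∣ binomial 0 t′
    p^e∣C = p^e∣m*n⇒p^e∣m e (p∤p*y+a 0 (suc b) z<s b<p)
              (subst (p ^ e ∣_) (*-comm (p * 0 + suc b) _) (noCarry-divides e b<p c<p b+c<p p^e∣))
  ... | s″@(suc _) = ≤-trans (IH s″ t′ s′+t′< e z<s (∣-trans p^e∣C (n∣m*n s″)))
                       (≤-trans (m≤n*m (s″ + t′) p) (p*[s′+t′]≤ s″ (suc b) t′ c))
    where
    p^e∣C : p ^ e ∣ binomial s″ t′
    p^e∣C = p^e∣m*n⇒p^e∣m e (p∤p*y+a s″ (suc b) z<s b<p)
              (subst (p ^ e ∣_) (*-comm (p * s″ + suc b) _) (noCarry-divides e b<p c<p b+c<p p^e∣))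
    s′+t′< : s″ + t′ < p * s″ + suc b + (p * t′ + c)
    s′+t′< = begin-strict
      s″ + t′                        ≤⟨ m≤n*m (s″ + t′) p ⟩
      p * (s″ + t′)                  <⟨ m<m+n (p * (s″ + t′)) z<s ⟩
      p * (s″ + t′) + (suc b + c)    ≡⟨ digits-+ s″ (suc b) t′ c ⟨
      p * s″ + suc b + (p * t′ + c)  ∎
      where open ≤-Reasoning

  carry : ∀ s′ b t′ c d → b < p → c < p → b + c ≡ p + d →
    Smaller (p * s′ + b + (p * t′ + c)) → Bound (p * s′ + b) (p * t′ + c)
  carry s′ b t′ c d _ _ _ _ zero 1≤S _ = ≤-trans 1≤S (m≤m+n _ _)
  carry s′ b t′ c d b<p c<p b+c≡p+d IH (suc e) 1≤S p^e∣ =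
    p^-step {e} (IH (suc s′) t′ s′+t′< e z<s p^e∣X) p*[1+s′+t′]≤
    where
    0<b : 0 < b
    0<b = n≢0⇒n>0 (λ { refl → <⇒≱ c<p (subst (p ≤_) (sym b+c≡p+d) (m≤m+n p d)) })
    p^e∣C : p ^ suc e ∣ binomial (p * s′ + b) (p * t′ + c)
    p^e∣C = p^e∣m*n⇒p^e∣m (suc e) (p∤p*y+a s′ b 0<b b<p) (subst (p ^ suc e ∣_) (*-comm (p * s′ + b) _) p^e∣)
    p^e∣X : p ^ e ∣ suc s′ * binomial (suc s′) t′
    p^e∣X = *-cancelˡ-∣ p (carry-divides (suc e) b<p c<p b+c≡p+d p^e∣C)
    p*[1+s′+t′]≤ : p * (suc s′ + t′) ≤ p * s′ + b + (p * t′ + c)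
    p*[1+s′+t′]≤ = begin
      p * suc (s′ + t′)              ≡⟨ *-suc p (s′ + t′) ⟩
      p + p * (s′ + t′)              ≡⟨ +-comm p _ ⟩
      p * (s′ + t′) + p              ≤⟨ +-monoʳ-≤ (p * (s′ + t′)) (m≤m+n p d) ⟩
      p * (s′ + t′) + (p + d)        ≡⟨ cong (p * (s′ + t′) +_) b+c≡p+d ⟨
      p * (s′ + t′) + (b + c)        ≡⟨ digits-+ s′ b t′ c ⟨
      p * s′ + b + (p * t′ + c)      ∎
      where open ≤-Reasoning
    s′+t′< : suc s′ + t′ < p * s′ + b + (p * t′ + c)
    s′+t′< = <-≤-trans (m<p*m z<s) p*[1+s′+t′]≤

  digit-step : ∀ s t → Smaller (s + t) → Bound s t
  digit-step s t IH with digits s | digits t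
  ... | s′ , b , b<p , refl | t′ , c , c<p , refl with b + c <? p
  ...   | yes b+c<p = noCarry s′ b t′ c b<p c<p b+c<p IH
  ...   | no b+c≮p = carry s′ b t′ c (b + c ∸ p) b<p c<p (sym (m+[n∸m]≡n (≮⇒≥ b+c≮p))) IH

  binomial-bound : ∀ s t → Bound s t
  binomial-bound s t = bounded (suc (s + t)) s t ≤-refl
    where
    bounded : ∀ n → Smaller n
    bounded zero _ _ ()
    bounded (suc n) s t (s≤s s+t≤n) = digit-step s t (λ s′ t′ lt → bounded n s′ t′ (<-≤-trans lt s+t≤n))

  binomial≢p^ : ∀ a b e → binomial (2 + a) (2 + b) ≢ p ^ e
  binomial≢p^ a b e C≡p^e = <⇒≱ (binomial-2+-> a b) (begin
      binomial (2 + a) (2 + b)  ≡⟨ C≡p^e ⟩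
      p ^ e                     ≤⟨ binomial-bound (2 + a) (2 + b) e z<s p^e∣ ⟩
      2 + a + (2 + b)           ∎)
    where
    open ≤-Reasoning
    p^e∣ : p ^ e ∣ (2 + a) * binomial (2 + a) (2 + b)
    p^e∣ = subst (_∣ _) C≡p^e (n∣m*n (2 + a))

  ∣p^∧≢1⇒p∣ : ∀ r {d} → d ∣ p ^ r → d ≢ 1 → p ∣ d
  ∣p^∧≢1⇒p∣ r d∣p^r d≢1 with ∣p^⇒≡p^ r d∣p^r
  ... | zero , d≡1 = contradiction d≡1 d≢1
  ... | suc e , refl = m∣m*n (p ^ e)

-- Tuples whose multinomial coefficient is a prime power

-- Head q x s m: x is the first entry of a tuple with multinomial q, and s and m are the sum
-- and the binomialProduct of the remaining entries.
data Head (q x s m : ℕ) : Set where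
  head-0  : x ≡ 0 → m ≡ q → Head q x s m
  head-1  : x ≡ 1 → suc s ≡ q → m ≡ 1 → Head q x s m
  head-q₁ : suc x ≡ q → s ≡ 1 → m ≡ 1 → Head q x s m

module PrimePowerMultinomials {p : ℕ} (prime : Prime p) where

  open PrimePowers prime

  private instance
    p≢0 : NonZero p
    p≢0 = prime⇒nonZero prime

  private
    *≡⇒∣ˡ : ∀ {a b n} → a * b ≡ n → a ∣ n
    *≡⇒∣ˡ {b = b} a*b≡n = subst (_ ∣_) a*b≡n (m∣m*n b)

    *≡⇒∣ʳ : ∀ {a b n} → a * b ≡ n → b ∣ n
    *≡⇒∣ʳ {a} a*b≡n = subst (_ ∣_) a*b≡n (n∣m*n a)

  tail-unit : ∀ r {m s} → (∀ g → m ≡ p ^ suc g → s ≡ p ^ suc g) → m ∣ p ^ r → ¬ p ∣ s → m ≡ 1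
  tail-unit r IH m∣p^r p∤s with ∣p^⇒≡p^ r m∣p^r
  ... | zero , m≡1 = m≡1
  ... | suc g , m≡p^g = contradiction (subst (p ∣_) (sym (IH g m≡p^g)) (m∣m*n (p ^ g))) p∤s

  head-step : ∀ e x s m → (∀ g → m ≡ p ^ suc g → s ≡ p ^ suc g) →
    binomial x s * m ≡ p ^ suc e → Head (p ^ suc e) x s m
  head-step e zero s m _ C*m≡q = head-0 refl (trans (sym (+-identityʳ m)) C*m≡q)
  head-step e (suc x) zero m IH C*m≡q =
    contradiction (IH e (trans (sym (+-identityʳ m)) C*m≡q)) (≢-nonZero⁻¹ (p ^ suc e) {{m^n≢0 p (suc e)}} ∘ sym)
  head-step e (suc x) (suc zero) m IH C*m≡q = head-q₁ (trans (sym (binomial-1ʳ (suc x))) C≡q) refl m≡1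
    where
    m≡1 : m ≡ 1
    m≡1 = tail-unit (suc e) IH (*≡⇒∣ʳ {binomial (suc x) 1} C*m≡q) p∤1
    C≡q : binomial (suc x) 1 ≡ p ^ suc e
    C≡q = trans (sym (*-identityʳ _)) (trans (cong (binomial (suc x) 1 *_) (sym m≡1)) C*m≡q)
  head-step e (suc zero) (suc (suc s)) m IH C*m≡q = head-1 refl (trans (sym (binomial-1ˡ (2 + s))) C≡q) m≡1
    where
    p∣3+s : p ∣ 3 + s
    p∣3+s = subst (p ∣_) (binomial-1ˡ (2 + s)) (∣p^∧≢1⇒p∣ (suc e) (*≡⇒∣ˡ {b = m} C*m≡q) C≢1)
      where
      C≢1 : binomial 1 (2 + s) ≢ 1
      C≢1 C≡1 = 1+n≢0 (suc-injective (trans (sym (binomial-1ˡ (2 + s))) C≡1))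
    m≡1 : m ≡ 1
    m≡1 = tail-unit (suc e) IH (*≡⇒∣ʳ {binomial 1 (2 + s)} C*m≡q)
            (λ p∣2+s → p∤1 (∣m+n∣m⇒∣n (subst (p ∣_) (+-comm 1 (2 + s)) p∣3+s) p∣2+s))
    C≡q : binomial 1 (2 + s) ≡ p ^ suc e
    C≡q = trans (sym (*-identityʳ _)) (trans (cong (binomial 1 (2 + s) *_) (sym m≡1)) C*m≡q)
  head-step e (suc (suc a)) (suc (suc b)) m _ C*m≡q with ∣p^⇒≡p^ (suc e) (*≡⇒∣ˡ {b = m} C*m≡q)
  ... | f , C≡p^f = contradiction C≡p^f (binomial≢p^ a b f)

  1<p^[1+e] : ∀ e → 1 < p ^ suc e
  1<p^[1+e] e = <-≤-trans 1<p (m≤m*n p (p ^ e) {{m^n≢0 p e}})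

  binomialProduct≡p^⇒sum≡ : ∀ {n} (v : Vec ℕ n) e → binomialProduct v ≡ p ^ suc e → sumV v ≡ p ^ suc e
  binomialProduct≡p^⇒sum≡ [] e 1≡q = contradiction 1≡q (<⇒≢ (1<p^[1+e] e))
  binomialProduct≡p^⇒sum≡ (x ∷ xs) e C*m≡q
    with head-step e x (sumV xs) (binomialProduct xs) (binomialProduct≡p^⇒sum≡ xs) C*m≡q
  ... | head-0 refl m≡q = binomialProduct≡p^⇒sum≡ xs e m≡q
  ... | head-1 refl 1+s≡q _ = 1+s≡q
  ... | head-q₁ 1+x≡q s≡1 _ = trans (cong (x +_) s≡1) (trans (+-comm x 1) 1+x≡q)

  head : ∀ e {n} x (xs : Vec ℕ n) → binomialProduct (x ∷ xs) ≡ p ^ suc e →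
    Head (p ^ suc e) x (sumV xs) (binomialProduct xs)
  head e x xs = head-step e x (sumV xs) (binomialProduct xs) (binomialProduct≡p^⇒sum≡ xs)

sumFrom : ℕ → ℕ → (ℕ → ℕ) → ℕ
sumFrom c zero f = 0
sumFrom c (suc m) f = f c + sumFrom (suc c) m f

+-interchange : ∀ a b c d → a + b + (c + d) ≡ a + c + (b + d)
+-interchange = solve-∀

InRange : ℕ → ℕ → ℕ → Set
InRange c m i = c ≤ i × i < c + m

private
  inRange-suc : ∀ {c m i} → InRange (suc c) m i → InRange c (suc m) i
  inRange-suc {c} {m} (c<i , i<) = <⇒≤ c<i , ≤-trans i< (≤-reflexive (sym (+-suc c m)))

sumFrom-cong : ∀ c m {f g} → (∀ i → InRange c m i → f i ≡ g i) → sumFrom c m f ≡ sumFrom c m g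
sumFrom-cong c zero _ = refl
sumFrom-cong c (suc m) f≡g =
  cong₂ _+_ (f≡g c (≤-refl , m<m+n c z<s)) (sumFrom-cong (suc c) m (λ i r → f≡g i (inRange-suc r)))

sumFrom-zero : ∀ c m {f} → (∀ i → InRange c m i → f i ≡ 0) → sumFrom c m f ≡ 0
sumFrom-zero c zero _ = refl
sumFrom-zero c (suc m) f≡0 =
  cong₂ _+_ (f≡0 c (≤-refl , m<m+n c z<s)) (sumFrom-zero (suc c) m (λ i r → f≡0 i (inRange-suc r)))

sumFrom-single : ∀ c m a {f} → InRange c m a → (∀ i → InRange c m i → i ≢ a → f i ≡ 0) → sumFrom c m f ≡ f a
sumFrom-single c zero a (c≤a , a<c+0) _ = contradiction (≤-trans (≤-reflexive (+-identityʳ c)) c≤a) (<⇒≱ a<c+0)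
sumFrom-single c (suc m) a {f} (c≤a , a<) others with c ≟ a
... | yes refl = trans (cong (f c +_) (sumFrom-zero (suc c) m (λ i r → others i (inRange-suc r) (>⇒≢ (proj₁ r))))) (+-identityʳ _)
... | no c≢a = trans (cong (_+ sumFrom (suc c) m f) (others c (≤-refl , m<m+n c z<s) c≢a))
                (sumFrom-single (suc c) m a (≤∧≢⇒< c≤a c≢a , ≤-trans a< (≤-reflexive (+-suc c m)))
                  (λ i r → others i (inRange-suc r)))

sumFrom-+ : ∀ c m f g → sumFrom c m (λ i → f i + g i) ≡ sumFrom c m f + sumFrom c m g
sumFrom-+ c zero f g = refl
sumFrom-+ c (suc m) f g = trans (cong (f c + g c +_) (sumFrom-+ (suc c) m f g)) (+-interchange (f c) (g c) _ _)

sumFrom-shift : ∀ c m f → sumFrom (suc c) m f ≡ sumFrom c m (λ i → f (suc i))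
sumFrom-shift c zero f = refl
sumFrom-shift c (suc m) f = cong (f (suc c) +_) (sumFrom-shift (suc c) m f)

sumFrom-prefix : ∀ c m K {f} → K ≤ m → (∀ i → InRange c K i → f i ≡ 1) → (∀ i → c + K ≤ i → f i ≡ 0) →
  sumFrom c m f ≡ K
sumFrom-prefix c m zero _ _ f≡0 = sumFrom-zero c m (λ i (c≤i , _) → f≡0 i (≤-trans (≤-reflexive (+-identityʳ c)) c≤i))
sumFrom-prefix c (suc m) (suc K) (s≤s K≤m) f≡1 f≡0 =
  cong₂ _+_ (f≡1 c (≤-refl , m<m+n c z<s))
    (sumFrom-prefix (suc c) m K K≤m (λ i r → f≡1 i (inRange-suc r))
      (λ i c+K≤i → f≡0 i (≤-trans (≤-reflexive (+-suc c K)) c+K≤i)))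

module _ {A : Set} where

  sum-map-*ˡ : ∀ a (f : A → ℕ) xs → sum (map (λ x → a * f x) xs) ≡ a * sum (map f xs)
  sum-map-*ˡ a f [] = sym (*-zeroʳ a)
  sum-map-*ˡ a f (x ∷ xs) = trans (cong (a * f x +_) (sum-map-*ˡ a f xs)) (sym (*-distribˡ-+ a (f x) _))

  sum-map-cong : ∀ {f g : A → ℕ} → (∀ x → f x ≡ g x) → ∀ xs → sum (map f xs) ≡ sum (map g xs)
  sum-map-cong f≗g xs = cong sum (map-cong f≗g xs)

  sum-map-zero : ∀ xs → sum (map (λ (_ : A) → 0) xs) ≡ 0
  sum-map-zero [] = refl
  sum-map-zero (_ ∷ xs) = sum-map-zero xs

  length-filter≡sum : ∀ {P : A → Set} (P? : Decidable P) (f : A → ℕ) →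
    (∀ x → P x → f x ≡ 1) → (∀ x → ¬ P x → f x ≡ 0) → ∀ xs → length (filter P? xs) ≡ sum (map f xs)
  length-filter≡sum P? f P⇒1 ¬P⇒0 [] = refl
  length-filter≡sum P? f P⇒1 ¬P⇒0 (x ∷ xs) with P? x
  ... | yes Px = cong₂ _+_ (sym (P⇒1 x Px)) (length-filter≡sum P? f P⇒1 ¬P⇒0 xs)
  ... | no ¬Px = cong₂ _+_ (sym (¬P⇒0 x ¬Px)) (length-filter≡sum P? f P⇒1 ¬P⇒0 xs)

sum-map-concatMap : ∀ {A B : Set} (f : B → ℕ) (g : A → List B) xs →
  sum (map f (concatMap g xs)) ≡ sum (map (λ x → sum (map f (g x))) xs)
sum-map-concatMap f g [] = refl
sum-map-concatMap f g (x ∷ xs) = begin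
    sum (map f (g x ++ concatMap g xs))
  ≡⟨ cong sum (map-++ f (g x) (concatMap g xs)) ⟩
    sum (map f (g x) ++ map f (concatMap g xs))
  ≡⟨ sum-++ (map f (g x)) _ ⟩
    sum (map f (g x)) + sum (map f (concatMap g xs))
  ≡⟨ cong (sum (map f (g x)) +_) (sum-map-concatMap f g xs) ⟩
    sum (map f (g x)) + sum (map (λ x → sum (map f (g x))) xs)
  ∎
  where open ≡-Reasoning

sum-map-applyUpTo : ∀ (g h : ℕ → ℕ) K → sum (map g (applyUpTo h K)) ≡ sumFrom 0 K (g ∘ h)
sum-map-applyUpTo g h zero = refl
sum-map-applyUpTo g h (suc K) =
  cong (g (h 0) +_) (trans (sum-map-applyUpTo g (h ∘ suc) K) (sym (sumFrom-shift 0 K (g ∘ h))))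

tupleSum : ∀ m k → (Vec ℕ m → ℕ) → ℕ
tupleSum m k f = sum (map f (tuplesBounded m k))

tupleSum-suc : ∀ m k f → tupleSum (suc m) k f ≡ sumFrom 0 (suc k) (λ x → tupleSum m k (λ xs → f (x ∷ xs)))
tupleSum-suc m k f = begin
    sum (map f (concatMap (λ x → map (x ∷_) (tuplesBounded m k)) (upTo (suc k))))
  ≡⟨ sum-map-concatMap f (λ x → map (x ∷_) (tuplesBounded m k)) (upTo (suc k)) ⟩
    sum (map (λ x → sum (map f (map (x ∷_) (tuplesBounded m k)))) (upTo (suc k)))
  ≡⟨ sum-map-cong (λ x → cong sum (map-∘ (tuplesBounded m k))) (upTo (suc k)) ⟨
    sum (map (λ x → tupleSum m k (λ xs → f (x ∷ xs))) (upTo (suc k)))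
  ≡⟨ sum-map-applyUpTo _ (λ x → x) (suc k) ⟩
    sumFrom 0 (suc k) (λ x → tupleSum m k (λ xs → f (x ∷ xs)))
  ∎
  where open ≡-Reasoning

isZero : ∀ {m} → Vec ℕ m → ℕ
isZero [] = 1
isZero (zero ∷ xs) = isZero xs
isZero (suc _ ∷ _) = 0

-- single a c w v = 1 when v is a times a unit vector whose position has weight i (weights
-- counted from c) with a * i ≡ w, and 0 otherwise.
single : ∀ {m} → ℕ → ℕ → ℕ → Vec ℕ m → ℕ
single a c w [] = 0
single a c w (zero ∷ xs) = single a (suc c) w xs
single a c w (suc x ∷ xs) = δ (suc x) a * δ (a * c) w * isZero xs

tupleSum-isZero : ∀ m k → tupleSum m k isZero ≡ 1
tupleSum-isZero zero k = refl
tupleSum-isZero (suc m) k = begin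
    tupleSum (suc m) k isZero
  ≡⟨ tupleSum-suc m k isZero ⟩
    tupleSum m k isZero + sumFrom 1 k (λ x → tupleSum m k (λ xs → isZero (x ∷ xs)))
  ≡⟨ cong₂ _+_ (tupleSum-isZero m k) (sumFrom-zero 1 k nonzero-head) ⟩
    1
  ∎
  where
  open ≡-Reasoning
  nonzero-head : ∀ x → InRange 1 k x → tupleSum m k (λ xs → isZero (x ∷ xs)) ≡ 0
  nonzero-head (suc x) _ = sum-map-zero (tuplesBounded m k)

tupleSum-single : ∀ m k a c w → 1 ≤ a → a ≤ k → tupleSum m k (single a c w) ≡ sumFrom c m (λ i → δ (a * i) w)
tupleSum-single zero k a c w _ _ = refl
tupleSum-single (suc m) k a@(suc a′) c w 1≤a a≤k = begin
    tupleSum (suc m) k (single a c w)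
  ≡⟨ tupleSum-suc m k (single a c w) ⟩
    tupleSum m k (single a (suc c) w) + sumFrom 1 k head
  ≡⟨ cong₂ _+_ (tupleSum-single m k a (suc c) w 1≤a a≤k)
       (sumFrom-single 1 k a (1≤a , s≤s a≤k) (λ { (suc x) _ 1+x≢a → head-off x 1+x≢a })) ⟩
    sumFrom (suc c) m (λ i → δ (a * i) w) + head a
  ≡⟨ +-comm _ (head a) ⟩
    head a + sumFrom (suc c) m (λ i → δ (a * i) w)
  ≡⟨ cong (_+ sumFrom (suc c) m (λ i → δ (a * i) w)) (trans (head-suc a′) (cong (_* δ (a * c) w) (δ-refl a))) ⟩
    1 * δ (a * c) w + sumFrom (suc c) m (λ i → δ (a * i) w)
  ≡⟨ cong (_+ sumFrom (suc c) m (λ i → δ (a * i) w)) (*-identityˡ (δ (a * c) w)) ⟩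
    δ (a * c) w + sumFrom (suc c) m (λ i → δ (a * i) w)
  ∎
  where
  open ≡-Reasoning
  head : ℕ → ℕ
  head x = tupleSum m k (λ xs → single a c w (x ∷ xs))
  head-suc : ∀ x → head (suc x) ≡ δ (suc x) a * δ (a * c) w
  head-suc x = begin
      tupleSum m k (λ xs → δ (suc x) a * δ (a * c) w * isZero xs)
    ≡⟨ sum-map-*ˡ (δ (suc x) a * δ (a * c) w) isZero (tuplesBounded m k) ⟩
      δ (suc x) a * δ (a * c) w * tupleSum m k isZero
    ≡⟨ cong (δ (suc x) a * δ (a * c) w *_) (tupleSum-isZero m k) ⟩
      δ (suc x) a * δ (a * c) w * 1
    ≡⟨ *-identityʳ _ ⟩
      δ (suc x) a * δ (a * c) w
    ∎
  head-off : ∀ x → suc x ≢ a → head (suc x) ≡ 0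
  head-off x 1+x≢a = trans (head-suc x) (cong (_* δ (a * c) w) (δ-≢ 1+x≢a))

private
  *≢0⇒≢0ˡ : ∀ {m n} → m * n ≢ 0 → m ≢ 0
  *≢0⇒≢0ˡ {n = n} mn≢0 m≡0 = mn≢0 (cong (_* n) m≡0)

  *≢0⇒≢0ʳ : ∀ {m n} → m * n ≢ 0 → n ≢ 0
  *≢0⇒≢0ʳ {m} mn≢0 n≡0 = mn≢0 (trans (cong (m *_) n≡0) (*-zeroʳ m))

binomial≡1⇒0 : ∀ a b → binomial (suc a) b ≡ 1 → b ≡ 0
binomial≡1⇒0 a zero _ = refl
binomial≡1⇒0 a (suc b) C≡1 = contradiction (≤-trans (binomial-lowerBound a b) (≤-reflexive C≡1)) λ { (s≤s ()) }

isZero≢0⇒sum≡0 : ∀ {m} (v : Vec ℕ m) → isZero v ≢ 0 → sumV v ≡ 0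
isZero≢0⇒sum≡0 [] _ = refl
isZero≢0⇒sum≡0 (zero ∷ xs) z≢0 = isZero≢0⇒sum≡0 xs z≢0
isZero≢0⇒sum≡0 (suc _ ∷ _) z≢0 = contradiction refl z≢0

sum≡0⇒isZero≡1 : ∀ {m} (v : Vec ℕ m) → sumV v ≡ 0 → isZero v ≡ 1
sum≡0⇒isZero≡1 [] _ = refl
sum≡0⇒isZero≡1 (zero ∷ xs) s≡0 = sum≡0⇒isZero≡1 xs s≡0

sum≡0⇒weightedSumFrom≡0 : ∀ {m} c (v : Vec ℕ m) → sumV v ≡ 0 → weightedSumFrom c v ≡ 0
sum≡0⇒weightedSumFrom≡0 c [] _ = refl
sum≡0⇒weightedSumFrom≡0 c (zero ∷ xs) s≡0 = cong₂ _+_ (*-zeroʳ c) (sum≡0⇒weightedSumFrom≡0 (suc c) xs s≡0)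

single-sound : ∀ {m} a c w (v : Vec ℕ m) → single a c w v ≢ 0 →
  sumV v ≡ a × weightedSumFrom c v ≡ w × binomialProduct v ≡ 1
single-sound a c w [] s≢0 = contradiction refl s≢0
single-sound a c w (zero ∷ xs) s≢0 with single-sound a (suc c) w xs s≢0
... | sum≡a , W≡w , C≡1 =
  sum≡a , trans (cong (_+ weightedSumFrom (suc c) xs) (*-zeroʳ c)) W≡w , trans (+-identityʳ (binomialProduct xs)) C≡1
single-sound a c w (suc x ∷ xs) s≢0 =
  trans (cong (suc x +_) xs-sum≡0) (trans (+-identityʳ (suc x)) 1+x≡a) ,
  trans (cong₂ _+_ (trans (*-comm c (suc x)) (cong (_* c) 1+x≡a)) (sum≡0⇒weightedSumFrom≡0 (suc c) xs xs-sum≡0))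
        (trans (+-identityʳ (a * c)) a*c≡w) ,
  cong₂ _*_ (cong (binomial (suc x)) xs-sum≡0) (sum≡0⇒binomialProduct≡1 xs xs-sum≡0)
  where
  δ*δ≢0 : δ (suc x) a * δ (a * c) w ≢ 0
  δ*δ≢0 = *≢0⇒≢0ˡ {n = isZero xs} s≢0
  1+x≡a : suc x ≡ a
  1+x≡a = δ≢0⇒≡ (*≢0⇒≢0ˡ {n = δ (a * c) w} δ*δ≢0)
  a*c≡w : a * c ≡ w
  a*c≡w = δ≢0⇒≡ (*≢0⇒≢0ʳ {m = δ (suc x) a} δ*δ≢0)
  xs-sum≡0 : sumV xs ≡ 0
  xs-sum≡0 = isZero≢0⇒sum≡0 xs (*≢0⇒≢0ʳ {m = δ (suc x) a * δ (a * c) w} s≢0)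

single-complete : ∀ {m} a c (v : Vec ℕ m) → 1 ≤ a → sumV v ≡ a → binomialProduct v ≡ 1 →
  single a c (weightedSumFrom c v) v ≡ 1
single-complete a c [] 1≤a 0≡a _ = contradiction (sym 0≡a) (≢-nonZero⁻¹ a {{>-nonZero 1≤a}})
single-complete a c (zero ∷ xs) 1≤a sum≡a C≡1 =
  trans (cong (λ w → single a (suc c) w xs) (cong (_+ weightedSumFrom (suc c) xs) (*-zeroʳ c)))
        (single-complete a (suc c) xs 1≤a sum≡a (trans (sym (+-identityʳ (binomialProduct xs))) C≡1))
single-complete a c (suc x ∷ xs) 1≤a sum≡a C≡1 = begin
    δ (suc x) a * δ (a * c) (c * suc x + weightedSumFrom (suc c) xs) * isZero xs
  ≡⟨ cong₃ (λ d d′ z → d * d′ * z) (trans (cong (λ y → δ y a) 1+x≡a) (δ-refl a))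
       (trans (cong (δ (a * c)) W≡a*c) (δ-refl (a * c))) (sum≡0⇒isZero≡1 xs xs-sum≡0) ⟩
    1
  ∎
  where
  open ≡-Reasoning
  cong₃ : ∀ (f : ℕ → ℕ → ℕ → ℕ) {x y z x′ y′ z′} → x ≡ x′ → y ≡ y′ → z ≡ z′ → f x y z ≡ f x′ y′ z′
  cong₃ f refl refl refl = refl
  xs-sum≡0 : sumV xs ≡ 0
  xs-sum≡0 = binomial≡1⇒0 x (sumV xs) (m*n≡1⇒m≡1 _ _ C≡1)
  1+x≡a : suc x ≡ a
  1+x≡a = trans (sym (trans (cong (suc x +_) xs-sum≡0) (+-identityʳ _))) sum≡a
  W≡a*c : c * suc x + weightedSumFrom (suc c) xs ≡ a * c
  W≡a*c = trans (cong₂ _+_ (trans (*-comm c (suc x)) (cong (_* c) 1+x≡a)) (sum≡0⇒weightedSumFrom≡0 (suc c) xs xs-sum≡0))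
                (+-identityʳ _)

module Pairs (Q : ℕ) where

  q₁ : ℕ
  q₁ = 2 + Q

  q : ℕ
  q = suc q₁

  -- pair c w v = 1 when v = q₁ eᵤ + eᵥ with u ≢ v, where the weighted sum of v
  -- (weights counted from c) is w, and 0 otherwise. The subtractions w ∸ c are truncated;
  -- pair-sound recovers c ≤ w from the positive weight of the tail.
  pair : ∀ {m} → ℕ → ℕ → Vec ℕ m → ℕ
  pair c w [] = 0
  pair c w (zero ∷ xs) = pair (suc c) w xs
  pair c w (suc zero ∷ xs) = single q₁ (suc c) (w ∸ c) xs
  pair c w (suc (suc x) ∷ xs) = δ (2 + x) q₁ * single 1 (suc c) (w ∸ q₁ * c) xs

  private
    ∸-restore : ∀ {a s} c w → 1 ≤ a → a ≤ s → s ≡ w ∸ c → c + s ≡ w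
    ∸-restore c w 1≤a a≤s s≡w∸c =
      trans (cong (c +_) s≡w∸c) (1≤n∸m⇒m+[n∸m]≡n c w (≤-trans (≤-trans 1≤a a≤s) (≤-reflexive s≡w∸c)))

  pair-sound : ∀ {m} c w (v : Vec ℕ m) → pair c w v ≢ 0 →
    sumV v ≡ q × weightedSumFrom c v ≡ w × binomialProduct v ≡ q
  pair-sound c w [] p≢0 = contradiction refl p≢0
  pair-sound c w (zero ∷ xs) p≢0 with pair-sound (suc c) w xs p≢0
  ... | sum≡q , W≡w , C≡q =
    sum≡q , trans (cong (_+ weightedSumFrom (suc c) xs) (*-zeroʳ c)) W≡w , trans (+-identityʳ (binomialProduct xs)) C≡q
  pair-sound c w (suc zero ∷ xs) p≢0 with single-sound q₁ (suc c) (w ∸ c) xs p≢0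
  ... | sum≡q₁ , W≡w∸c , C≡1 =
    cong suc sum≡q₁ ,
    trans (cong (_+ weightedSumFrom (suc c) xs) (*-identityʳ c))
      (∸-restore c w (s≤s z≤n) (≤-trans (≤-reflexive (sym sum≡q₁)) (sum≤weightedSumFrom c xs)) W≡w∸c) ,
    trans (cong₂ _*_ (trans (binomial-1ˡ (sumV xs)) (cong suc sum≡q₁)) C≡1) (*-identityʳ q)
  pair-sound c w (suc (suc x) ∷ xs) p≢0 with single-sound 1 (suc c) (w ∸ q₁ * c) xs (*≢0⇒≢0ʳ {m = δ (2 + x) q₁} p≢0)
  ... | sum≡1 , W≡w∸q₁c , C≡1 =
    trans (cong₂ _+_ 2+x≡q₁ sum≡1) (+-comm q₁ 1) ,
    trans (cong (_+ weightedSumFrom (suc c) xs) (trans (*-comm c (2 + x)) (cong (_* c) 2+x≡q₁)))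
      (∸-restore (q₁ * c) w ≤-refl (≤-trans (≤-reflexive (sym sum≡1)) (sum≤weightedSumFrom c xs)) W≡w∸q₁c) ,
    trans (cong₂ _*_ (trans (cong₂ binomial 2+x≡q₁ sum≡1) (binomial-1ʳ q₁)) C≡1) (*-identityʳ q)
    where
    2+x≡q₁ : 2 + x ≡ q₁
    2+x≡q₁ = δ≢0⇒≡ (*≢0⇒≢0ˡ {n = single 1 (suc c) (w ∸ q₁ * c) xs} p≢0)

  HeadsClassified : Set
  HeadsClassified = ∀ {n} x (xs : Vec ℕ n) → binomialProduct (x ∷ xs) ≡ q → Head q x (sumV xs) (binomialProduct xs)

  pair-complete : HeadsClassified → ∀ {m} c (v : Vec ℕ m) → binomialProduct v ≡ q → pair c (weightedSumFrom c v) v ≡ 1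
  pair-complete heads c [] 1≡q = contradiction 1≡q λ ()
  pair-complete heads c (x ∷ xs) C≡q with heads x xs C≡q
  ... | head-0 refl m≡q =
    trans (cong (λ w → pair (suc c) w xs) (cong (_+ W) (*-zeroʳ c))) (pair-complete heads (suc c) xs m≡q)
    where W = weightedSumFrom (suc c) xs
  ... | head-1 refl 1+s≡q m≡1 =
    trans (cong (λ w → single q₁ (suc c) w xs) (trans (cong (λ y → y + W ∸ c) (*-identityʳ c)) (m+n∸m≡n c W)))
      (single-complete q₁ (suc c) xs (s≤s z≤n) (suc-injective 1+s≡q) m≡1)
    where W = weightedSumFrom (suc c) xs
  ... | head-q₁ refl s≡1 m≡1 =
    cong₂ _*_ (δ-refl q₁)
      (trans (cong (λ w → single 1 (suc c) w xs) (trans (cong (λ y → y + W ∸ q₁ * c) (*-comm c q₁)) (m+n∸m≡n (q₁ * c) W)))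
        (single-complete 1 (suc c) xs ≤-refl s≡1 m≡1))
    where W = weightedSumFrom (suc c) xs

  tupleSum-pair-suc : ∀ m c w → tupleSum (suc m) q (pair c w) ≡
    tupleSum m q (pair (suc c) w) + tupleSum m q (single q₁ (suc c) (w ∸ c)) + tupleSum m q (single 1 (suc c) (w ∸ q₁ * c))
  tupleSum-pair-suc m c w = begin
      tupleSum (suc m) q (pair c w)
    ≡⟨ tupleSum-suc m q (pair c w) ⟩
      head 0 + (head 1 + sumFrom 2 q₁ head)
    ≡⟨ cong (λ t → head 0 + (head 1 + t))
         (sumFrom-single 2 q₁ q₁ {head} (s≤s (s≤s z≤n) , m<n+m q₁ {2} z<s) off-diagonal) ⟩
      head 0 + (head 1 + head q₁)
    ≡⟨ +-assoc (head 0) _ _ ⟨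
      head 0 + head 1 + head q₁
    ≡⟨ cong (head 0 + head 1 +_) (trans (head-suc-suc Q) (cong (_* T₁) (δ-refl q₁))) ⟩
      head 0 + head 1 + 1 * T₁
    ≡⟨ cong (head 0 + head 1 +_) (*-identityˡ T₁) ⟩
      head 0 + head 1 + T₁
    ∎
    where
    open ≡-Reasoning
    head : ℕ → ℕ
    head x = tupleSum m q (λ xs → pair c w (x ∷ xs))
    T₁ = tupleSum m q (single 1 (suc c) (w ∸ q₁ * c))
    head-suc-suc : ∀ x → head (2 + x) ≡ δ (2 + x) q₁ * T₁
    head-suc-suc x = sum-map-*ˡ (δ (2 + x) q₁) (single 1 (suc c) (w ∸ q₁ * c)) (tuplesBounded m q)
    off-diagonal : ∀ x → InRange 2 q₁ x → x ≢ q₁ → head x ≡ 0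
    off-diagonal 1 (s≤s () , _)
    off-diagonal (suc (suc x)) _ 2+x≢q₁ = trans (head-suc-suc x) (cong (_* T₁) (δ-≢ 2+x≢q₁))

  -- The square of all position pairs (u, v) also contains the diagonal u = v, where q₁ u + u = q u.
  tupleSum-pair : ∀ m c w → tupleSum m q (pair c w) + sumFrom c m (λ u → δ (q * u) w) ≡
    sumFrom c m (λ u → sumFrom c m (λ v → δ (q₁ * u + v) w))
  tupleSum-pair zero c w = refl
  tupleSum-pair (suc m) c w = begin
      tupleSum (suc m) q (pair c w) + (δ (q * c) w + D)
    ≡⟨ cong (_+ (δ (q * c) w + D)) (tupleSum-pair-suc m c w) ⟩
      P + tupleSum m q (single q₁ (suc c) (w ∸ c)) + tupleSum m q (single 1 (suc c) (w ∸ q₁ * c)) + (δ (q * c) w + D)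
    ≡⟨ cong₂ (λ s t → P + s + t + (δ (q * c) w + D))
         (trans (tupleSum-single m q q₁ (suc c) (w ∸ c) (s≤s z≤n) (n≤1+n q₁)) (sym column))
         (trans (tupleSum-single m q 1 (suc c) (w ∸ q₁ * c) (s≤s z≤n) (s≤s z≤n)) (sym row)) ⟩
      P + Col + Row + (δ (q * c) w + D)
    ≡⟨ regroup P Col Row (δ (q * c) w) D ⟩
      (δ (q * c) w + Row) + (Col + (P + D))
    ≡⟨ cong₂ (λ d t → (d + Row) + (Col + t)) (cong (λ u → δ u w) (+-comm c (q₁ * c))) (tupleSum-pair m (suc c) w) ⟩
      (g c c + Row) + (Col + sumFrom (suc c) m (λ u → sumFrom (suc c) m (g u)))
    ≡⟨ cong ((g c c + Row) +_) (sumFrom-+ (suc c) m (λ u → g u c) (λ u → sumFrom (suc c) m (g u))) ⟨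
      sumFrom c (suc m) (λ u → sumFrom c (suc m) (g u))
    ∎
    where
    open ≡-Reasoning
    g : ℕ → ℕ → ℕ
    g u v = δ (q₁ * u + v) w
    P = tupleSum m q (pair (suc c) w)
    D = sumFrom (suc c) m (λ u → δ (q * u) w)
    Col = sumFrom (suc c) m (λ u → g u c)
    Row = sumFrom (suc c) m (g c)
    column : Col ≡ sumFrom (suc c) m (λ i → δ (q₁ * i) (w ∸ c))
    column = sumFrom-cong (suc c) m λ u (c<u , _) →
      trans (cong (λ x → δ x w) (+-comm (q₁ * u) c)) (δ-+ c (q₁ * u) w (≤-trans (≤-trans (s≤s z≤n) c<u) (m≤n*m u q₁)))
    row : Row ≡ sumFrom (suc c) m (λ i → δ (1 * i) (w ∸ q₁ * c))
    row = sumFrom-cong (suc c) m λ v (c<v , _) →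
      trans (δ-+ (q₁ * c) v w (≤-trans (s≤s z≤n) c<v)) (cong (λ x → δ x (w ∸ q₁ * c)) (sym (*-identityˡ v)))
    regroup : ∀ P a b d D → P + a + b + (d + D) ≡ (d + b) + (a + (P + D))
    regroup = solve-∀

  diagonal : ∀ n .{{_ : NonZero n}} → sumFrom 1 n (λ u → δ (q * u) n) ≡ δ 0 (n % q)
  diagonal n = by-cases (q ∣? n)
    where
    by-cases : Dec (q ∣ n) → sumFrom 1 n (λ u → δ (q * u) n) ≡ δ 0 (n % q)
    by-cases (yes q∣n@(divides k n≡k*q)) = begin
        sumFrom 1 n (λ u → δ (q * u) n)
      ≡⟨ sumFrom-single 1 n k (1≤k , s≤s k≤n) (λ u _ u≢k → δ-≢ (u≢k ∘ q*u≡n⇒u≡k)) ⟩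
        δ (q * k) n
      ≡⟨ cong (δ (q * k)) (trans n≡k*q (*-comm k q)) ⟩
        δ (q * k) (q * k)
      ≡⟨ δ-refl (q * k) ⟩
        1
      ≡⟨ cong (δ 0) (n∣m⇒m%n≡0 n q q∣n) ⟨
        δ 0 (n % q)
      ∎
      where
      open ≡-Reasoning
      1≤k : 1 ≤ k
      1≤k = n≢0⇒n>0 λ { refl → ≢-nonZero⁻¹ n n≡k*q }
      k≤n : k ≤ n
      k≤n = ≤-trans (m≤m*n k q) (≤-reflexive (sym n≡k*q))
      q*u≡n⇒u≡k : ∀ {u} → q * u ≡ n → u ≡ k
      q*u≡n⇒u≡k q*u≡n = *-cancelˡ-≡ _ _ q (trans q*u≡n (trans n≡k*q (*-comm k q)))
    by-cases (no q∤n) = trans (sumFrom-zero 1 n λ u _ → δ-≢ λ q*u≡n → q∤n (divides u (trans (sym q*u≡n) (*-comm q u))))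
                              (sym (δ-≢ λ 0≡n%q → q∤n (m%n≡0⇒n∣m n q (sym 0≡n%q))))

  private
    ≤/⇒*≤ : ∀ {u N} → u ≤ N / q₁ → q₁ * u ≤ N
    ≤/⇒*≤ {u} {N} u≤N/q₁ = ≤-trans (*-monoʳ-≤ q₁ u≤N/q₁) (subst (_≤ N) (*-comm (N / q₁) q₁) (m/n*n≤m N q₁))

    *≤⇒≤/ : ∀ {u N} → q₁ * u ≤ N → u ≤ N / q₁
    *≤⇒≤/ {u} {N} q₁u≤N = subst (_≤ N / q₁) (m*n/n≡m u q₁) (/-monoˡ-≤ q₁ (subst (_≤ N) (*-comm q₁ u) q₁u≤N))

  inner-sum : ∀ n u → sumFrom 1 n (λ v → δ (q₁ * u + v) n) ≡ sumFrom 1 n (λ v → δ v (n ∸ q₁ * u))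
  inner-sum n u = sumFrom-cong 1 n λ v (1≤v , _) → δ-+ (q₁ * u) v n 1≤v

  double-sum : ∀ n .{{_ : NonZero n}} → sumFrom 1 n (λ u → sumFrom 1 n (λ v → δ (q₁ * u + v) n)) ≡ (n ∸ 1) / q₁
  double-sum n = sumFrom-prefix 1 n K (≤-trans (m/n≤m (n ∸ 1) q₁) (m∸n≤m n 1)) short long
    where
    K = (n ∸ 1) / q₁
    short : ∀ u → InRange 1 K u → sumFrom 1 n (λ v → δ (q₁ * u + v) n) ≡ 1
    short u (_ , s≤s u≤K) = begin
        sumFrom 1 n (λ v → δ (q₁ * u + v) n)
      ≡⟨ inner-sum n u ⟩
        sumFrom 1 n (λ v → δ v (n ∸ q₁ * u))
      ≡⟨ sumFrom-single 1 n (n ∸ q₁ * u) (1≤n∸q₁u , s≤s (m∸n≤m n (q₁ * u))) (λ _ _ → δ-≢) ⟩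
        δ (n ∸ q₁ * u) (n ∸ q₁ * u)
      ≡⟨ δ-refl _ ⟩
        1
      ∎
      where
      open ≡-Reasoning
      1≤n∸q₁u : 1 ≤ n ∸ q₁ * u
      1≤n∸q₁u = m<n⇒0<n∸m (m≤pred[n]⇒suc[m]≤n (≤/⇒*≤ u≤K))
    long : ∀ u → 1 + K ≤ u → sumFrom 1 n (λ v → δ (q₁ * u + v) n) ≡ 0
    long u K<u = trans (inner-sum n u) (sumFrom-zero 1 n λ v (1≤v , _) → δ-≢ λ v≡n∸q₁u →
      <⇒≱ K<u (*≤⇒≤/ (suc[m]≤n⇒m≤pred[n] (q₁u<n (≤-trans 1≤v (≤-reflexive v≡n∸q₁u))))))
      where
      q₁u<n : 1 ≤ n ∸ q₁ * u → q₁ * u < n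
      q₁u<n 1≤n∸q₁u = m∸n≢0⇒n<m λ n∸q₁u≡0 → <⇒≱ 1≤n∸q₁u (≤-reflexive n∸q₁u≡0)

  M≡tupleSum-pair : HeadsClassified → ∀ n → M q n q ≡ tupleSum n q (pair 1 n)
  M≡tupleSum-pair heads n = length-filter≡sum _ (pair 1 n) P⇒1 ¬P⇒0 (tuplesBounded n q)
    where
    P⇒1 : ∀ v → sumV v ≡ q × weightedSum v ≡ n × multinomial v ≡ q → pair 1 n v ≡ 1
    P⇒1 v (_ , W≡n , C≡q) =
      subst (λ w → pair 1 w v ≡ 1) (trans (sym (weightedSum≡weightedSumFrom1 v)) W≡n)
        (pair-complete heads 1 v (trans (sym (multinomial≡binomialProduct v)) C≡q))
    ¬P⇒0 : ∀ v → ¬ (sumV v ≡ q × weightedSum v ≡ n × multinomial v ≡ q) → pair 1 n v ≡ 0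
    ¬P⇒0 v ¬P with pair 1 n v ≟ 0
    ... | yes pair≡0 = pair≡0
    ... | no pair≢0 with pair-sound 1 n v pair≢0
    ...   | sum≡q , W≡n , C≡q =
      contradiction (sum≡q , trans (weightedSum≡weightedSumFrom1 v) W≡n , trans (multinomial≡binomialProduct v) C≡q) ¬P

  M-diagonal : HeadsClassified → ∀ n .{{_ : NonZero n}} → M q n q + δ 0 (n % q) ≡ (n ∸ 1) / q₁
  M-diagonal heads n = begin
      M q n q + δ 0 (n % q)
    ≡⟨ cong₂ _+_ (M≡tupleSum-pair heads n) (sym (diagonal n)) ⟩
      tupleSum n q (pair 1 n) + sumFrom 1 n (λ u → δ (q * u) n)
    ≡⟨ tupleSum-pair n 1 n ⟩
      sumFrom 1 n (λ u → sumFrom 1 n (λ v → δ (q₁ * u + v) n))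
    ≡⟨ double-sum n ⟩
      (n ∸ 1) / q₁
    ∎
    where open ≡-Reasoning

M-off-diagonal : ∀ {p} → Prime p → ∀ e {q} n {k} → q ≡ p ^ suc e → k ≢ q → M q n k ≡ 0
M-off-diagonal {p} p-prime e {q} n {k} q≡p^ k≢q =
  trans (length-filter≡sum _ (λ _ → 0) never-counted (λ _ _ → refl) (tuplesBounded n k)) (sum-map-zero (tuplesBounded n k))
  where
  open PrimePowerMultinomials p-prime
  never-counted : ∀ v → sumV v ≡ k × weightedSum v ≡ n × multinomial v ≡ q → 0 ≡ 1
  never-counted v (sum≡k , _ , C≡q) = contradiction (trans (sym sum≡k) (trans sum≡p^ (sym q≡p^))) k≢q
    where
    sum≡p^ : sumV v ≡ p ^ suc e
    sum≡p^ = binomialProduct≡p^⇒sum≡ v e (trans (sym (multinomial≡binomialProduct v)) (trans C≡q q≡p^))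

open import Data.Integer using (+_; _-_)
import Data.Integer.Properties as ℤ

+[m+n]-+n≡+m : ∀ m n → + (m + n) - + n ≡ + m
+[m+n]-+n≡+m m n = trans (ℤ.[+m]-[+n]≡m⊖n (m + n) n) (trans (ℤ.⊖-≥ (m≤n+m n m)) (cong +_ (m+n∸n≡m m n)))

prime-power-count : ∀ {p} → Prime p → ∀ e q → q ≡ p ^ suc e → 2 < q → ∀ n k →
  .{{_ : NonZero n}} → .{{_ : NonZero (q ∸ 1)}} → .{{_ : NonZero q}} →
  + M q n k ≡ + δ q k Data.Integer.* (+ ((n ∸ 1) / (q ∸ 1)) - + δ 0 (n % q))
prime-power-count p-prime e q@(suc (suc (suc Q))) q≡p^ (s≤s (s≤s (s≤s _))) n k = by-cases (k ≟ q)
  where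
  open Pairs Q hiding (q)
  open PrimePowerMultinomials p-prime
  open ≡-Reasoning
  heads : HeadsClassified
  heads x xs C≡q = subst (λ q → Head q x (sumV xs) (binomialProduct xs)) (sym q≡p^) (head e x xs (trans C≡q q≡p^))
  D = δ 0 (n % q)
  by-cases : Dec (k ≡ q) → + M q n k ≡ + δ q k Data.Integer.* (+ ((n ∸ 1) / q₁) - + D)
  by-cases (no k≢q) = begin
      + M q n k
    ≡⟨ cong +_ (M-off-diagonal p-prime e n q≡p^ k≢q) ⟩
      + 0 Data.Integer.* (+ ((n ∸ 1) / q₁) - + D)
    ≡⟨ cong (λ d → + d Data.Integer.* (+ ((n ∸ 1) / q₁) - + D)) (δ-≢ (k≢q ∘ sym)) ⟨
      + δ q k Data.Integer.* (+ ((n ∸ 1) / q₁) - + D)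
    ∎
  by-cases (yes refl) = begin
      + M q n q
    ≡⟨ +[m+n]-+n≡+m (M q n q) D ⟨
      + (M q n q + D) - + D
    ≡⟨ cong (λ a → + a - + D) (M-diagonal heads n) ⟩
      + ((n ∸ 1) / q₁) - + D
    ≡⟨ ℤ.*-identityˡ (+ ((n ∸ 1) / q₁) - + D) ⟨
      + 1 Data.Integer.* (+ ((n ∸ 1) / q₁) - + D)
    ≡⟨ cong (λ d → + d Data.Integer.* (+ ((n ∸ 1) / q₁) - + D)) (δ-refl q) ⟨
      + δ q q Data.Integer.* (+ ((n ∸ 1) / q₁) - + D)
    ∎

theorem1 : (p n k r : ℕ) → Prime p → .{{_ : NonZero n}} → .{{_ : NonZero k}} → .{{_ : NonZero r}}
    → p ^ r > 2
    → .{{_ : NonZero (p ^ r ∸ 1)}} → .{{_ : NonZero (p ^ r)}}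
    → + M (p ^ r) n k ≡ + δ (p ^ r) k Data.Integer.* (+ ((n ∸ 1) / (p ^ r ∸ 1)) - + δ 0 (n % (p ^ r)))
theorem1 p n k zero _ (s≤s ())
theorem1 p n k (suc e) p-prime p^r>2 = prime-power-count p-prime e (p ^ suc e) refl p^r>2 n k
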